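{- For every finite, simple, undirected graph $G$ (with at least one vertex), $\chi_{pcf}(G)\leq 2\,\mathrm{scol}_2(G)-1$.
   Context: A $c$-colouring of a graph $G$ is a function $\psi:V(G)\to C$ with $|C|\leq c$; it is proper if $\psi(u)\neq\psi(v)$ for every edge $uv$. Writing $N(v)$ for the neighbourhood of $v$, $\psi$ is conflict-free if for every vertex $v$ with $|N(v)|>0$ there is a colour $\alpha\in C$ such that $|\{w\in N(v):\psi(w)=\alpha\}|=1$. The proper conflict-free chromatic number $\chi_{pcf}(G)$ is the minimum integer $c$ such that $G$ has a proper conflict-free $c$-colouring. For a total order $\preceq$ of $V(G)$, a vertex $v$ and an integer $s\geq 1$, let $R(G,\preceq,v,s)$ be the set of vertices $w$ for which there is a path $v=w_0,w_1,\dots,w_{s'}=w$ of length $s'\in[0,s]$ with $w\preceq v$ and $v\prec w_i$ for all $i\in\{1,\dots,s'-1\}$. The $s$-strong colouring number $\mathrm{scol}_s(G)$ is the minimum integer $c$ such that there is a total order $\preceq$ of $V(G)$ with $|R(G,\preceq,v,s)|\leq c$ for every vertex $v$. -}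

module Defs where

open import Data.Nat using (ℕ; zero; suc; _≤_; _<_)
open import Data.Fin using (Fin; toℕ; inject₁; fromℕ)
import Data.Fin as F
open import Data.List using (List; length)
open import Data.List.Membership.Propositional using (_∈_)
open import Data.Product using (Σ; ∃; _×_; _,_)
open import Relation.Binary.PropositionalEquality using (_≡_; _≢_)
open import Relation.Nullary using (¬_; Dec)
open import Function.Definitions using (Injective)

record Graph (n : ℕ) : Set₁ where
  field
    Adj   : Fin n → Fin n → Set
    sym   : ∀ {u v} → Adj u v → Adj v u
    irrefl : ∀ {v} → ¬ Adj v v
    dec   : ∀ u v → Dec (Adj u v)
open Graph public

Colouring : ℕ → ℕ → Set
Colouring n c = Fin n → Fin c

Proper : ∀ {n c} → Graph n → Colouring n c → Set
Proper G ψ = ∀ u v → Adj G u v → ψ u ≢ ψ v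

ConflictFree : ∀ {n c} → Graph n → Colouring n c → Set
ConflictFree {n} {c} G ψ =
  ∀ v → (∃ λ u → Adj G v u) →
    ∃ λ (α : Fin c) → ∃ λ u → Adj G v u × ψ u ≡ α ×
      (∀ u' → Adj G v u' → ψ u' ≡ α → u' ≡ u)

HasPCF : ∀ {n} → Graph n → ℕ → Set
HasPCF {n} G c = ∃ λ (ψ : Colouring n c) → Proper G ψ × ConflictFree G ψ

IsChiPCF : ∀ {n} → Graph n → ℕ → Set
IsChiPCF G k = HasPCF G k × (∀ c → HasPCF G c → k ≤ c)

TotalOrder : ℕ → Set
TotalOrder n = Σ (Fin n → Fin n) Injective′
  where Injective′ : (Fin n → Fin n) → Set
        Injective′ f = Injective _≡_ _≡_ f

_⪯[_]_ : ∀ {n} → Fin n → TotalOrder n → Fin n → Set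
u ⪯[ (r , _) ] v = toℕ (r u) ≤ toℕ (r v)

_≺[_]_ : ∀ {n} → Fin n → TotalOrder n → Fin n → Set
u ≺[ (r , _) ] v = toℕ (r u) < toℕ (r v)

record GoodPath {n} (G : Graph n) (O : TotalOrder n) (v w : Fin n) (s' : ℕ) : Set where
  field
    p        : Fin (suc s') → Fin n
    start    : p F.zero ≡ v
    end      : p (fromℕ s') ≡ w
    edges    : ∀ (i : Fin s') → Adj G (p (inject₁ i)) (p (F.suc i))
    distinct : Injective _≡_ _≡_ p
    internal : ∀ (i : Fin (suc s')) → i ≢ F.zero → i ≢ fromℕ s' → v ≺[ O ] p i

InR : ∀ {n} → Graph n → TotalOrder n → Fin n → ℕ → Fin n → Set
InR G O v s w = (w ⪯[ O ] v) × ∃ λ s' → s' ≤ s × GoodPath G O v w s'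

RBounded : ∀ {n} → Graph n → TotalOrder n → Fin n → ℕ → ℕ → Set
RBounded {n} G O v s c =
  ∃ λ (L : List (Fin n)) → length L ≤ c × (∀ w → InR G O v s w → w ∈ L)

HasScol : ∀ {n} → Graph n → ℕ → ℕ → Set
HasScol {n} G s c = ∃ λ (O : TotalOrder n) → ∀ v → RBounded G O v s c

IsScol : ∀ {n} → Graph n → ℕ → ℕ → Set
IsScol G s k = HasScol G s k × (∀ c → HasScol G s c → k ≤ c)

module Submission where

-- Colour greedily along an order witnessing scol₂(G) ≤ σ. A vertex w avoids the
-- colours of the other vertices of R(w, 2) and of the least neighbours of its
-- lower neighbours: at most 2(σ − 1) colours, so 2σ − 1 suffice. Properness is
-- then immediate, and the least neighbour ℓ of v is uniquely coloured in N(v):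
-- for another neighbour u′ (necessarily ℓ ≺ u′), either v ≺ u′ and ℓ is the
-- least neighbour of a lower neighbour of u′, or u′ ≺ v and the path u′ v ℓ
-- puts ℓ in R(u′, 2).

open import Defs hiding (sym)
open import Data.Nat using (ℕ; zero; suc; _≤_; _<_; _*_; _∸_; _+_; z≤n; s≤s; _≤?_)
open import Data.Nat.Properties
open import Data.Fin as F using (Fin; toℕ)
open import Data.Fin.Properties using (toℕ-injective; toℕ<n; any?; ¬∀⟶∃¬; pigeonhole)
import Data.Fin.Properties as Fin
open import Data.List using (List; length; map; filter; _++_)
open import Data.List.Properties using (length-map; length-++; filter-notAll)
open import Data.List.Membership.Propositional using (_∈_; _∉_)
open import Data.List.Membership.Propositional.Properties
  using (∈-map⁺; ∈-++⁺ˡ; ∈-++⁺ʳ; ∈-filter⁺)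
open import Data.List.Membership.Setoid.Properties using (index-injective)
import Data.List.Relation.Unary.Any as Any
open import Data.Product using (∃; _×_; _,_; proj₁; proj₂)
open import Data.Sum using (_⊎_; inj₁; inj₂; [_,_]′)
open import Data.Empty using (⊥-elim)
open import Function using (_∘_; const)
open import Function.Definitions using (Injective)
open import Relation.Nullary using (¬_; yes; no; ¬?; contradiction)
open import Relation.Unary using (Pred; Decidable)
open import Relation.Binary.PropositionalEquality
open import Relation.Binary.Definitions using (tri<; tri≈; tri>)
open import Data.Vec.Functional using (updateAt)
open import Data.Vec.Functional.Properties using (updateAt-updates; updateAt-minimal)

length<⇒∃∉ : ∀ {c} (xs : List (Fin c)) → length xs < c → ∃ λ α → α ∉ xs
length<⇒∃∉ {c} xs len = ¬∀⟶∃¬ c (_∈ xs) (λ α → Any.any? (α F.≟_) xs) notAllListed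
  where
    notAllListed : ¬ (∀ α → α ∈ xs)
    notAllListed all∈ with pigeonhole len (Any.index ∘ all∈)
    ... | i , j , i<j , eq = Fin.<⇒≢ i<j (index-injective (setoid _) (all∈ i) (all∈ j) eq)

least? : ∀ {n p} {P : Pred (Fin n) p} → Decidable P → (g : Fin n → ℕ) →
         (∀ u → ¬ P u) ⊎ ∃ λ u → P u × ∀ {u'} → P u' → g u ≤ g u'
least? {zero} P? g = inj₁ λ ()
least? {suc n} P? g with least? (P? ∘ F.suc) (g ∘ F.suc) | P? F.zero
... | inj₁ none | no ¬p₀ = inj₁ λ { F.zero p → ¬p₀ p ; (F.suc u) p → none u p }
... | inj₁ none | yes p₀ =
  inj₂ (F.zero , p₀ , λ { {F.zero} _ → ≤-refl ; {F.suc u} p → ⊥-elim (none u p) })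
... | inj₂ (u , p , min) | no ¬p₀ =
  inj₂ (F.suc u , p , λ { {F.zero} p₀ → ⊥-elim (¬p₀ p₀) ; {F.suc u'} p' → min p' })
... | inj₂ (u , p , min) | yes p₀ with g F.zero ≤? g (F.suc u)
...   | yes ≤u =
  inj₂ (F.zero , p₀ , λ { {F.zero} _ → ≤-refl ; {F.suc u'} p' → ≤-trans ≤u (min p') })
...   | no ≰u =
  inj₂ (F.suc u , p , λ { {F.zero} _ → <⇒≤ (≰⇒> ≰u) ; {F.suc u'} p' → min p' })

twice<2*∸1 : ∀ r s → r < s → r + r < 2 * s ∸ 1
twice<2*∸1 r s r<s = ≤-trans (≤-reflexive 1+r+r≡2*[1+r]∸1) (∸-monoˡ-≤ 1 (*-monoʳ-≤ 2 r<s))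
  where
    1+r+r≡2*[1+r]∸1 : suc (r + r) ≡ 2 * suc r ∸ 1
    1+r+r≡2*[1+r]∸1 = trans (sym (+-suc r r)) (cong (λ t → r + suc t) (sym (+-identityʳ r)))

module _ {n : ℕ} (O : TotalOrder n) where

  rank : Fin n → ℕ
  rank v = toℕ (proj₁ O v)

  rank-injective : ∀ {u v} → rank u ≡ rank v → u ≡ v
  rank-injective = proj₂ O ∘ toℕ-injective

  ≺⇒≢ : ∀ {u v} → u ≺[ O ] v → u ≢ v
  ≺⇒≢ u≺v refl = <-irrefl refl u≺v

  ⪯∧≢⇒≺ : ∀ {u v} → u ⪯[ O ] v → u ≢ v → u ≺[ O ] v
  ⪯∧≢⇒≺ u⪯v u≢v = ≤∧≢⇒< u⪯v (u≢v ∘ rank-injective)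

  ≢⇒≺⊎≻ : ∀ {u v} → u ≢ v → u ≺[ O ] v ⊎ v ≺[ O ] u
  ≢⇒≺⊎≻ {u} {v} u≢v with <-cmp (rank u) (rank v)
  ... | tri< u≺v _ _ = inj₁ u≺v
  ... | tri≈ _ eq _  = contradiction (rank-injective eq) u≢v
  ... | tri> _ _ v≺u = inj₂ v≺u

Avoids : ∀ {n c} → (Fin n → Fin n → Set) → (Fin n → Fin c) → Fin n → Set
Avoids Conflict ψ w = ∀ {x} → Conflict w x → ψ w ≢ ψ x

module _ {n c : ℕ} (O : TotalOrder n) (Conflict : Fin n → Fin n → Set)
         (downward : ∀ {w x} → Conflict w x → x ≺[ O ] w)
         (covered : ∀ w → ∃ λ xs → length xs < c × ∀ {x} → Conflict w x → x ∈ xs) where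

  AvoidsBelow : ℕ → (Fin n → Fin c) → Set
  AvoidsBelow k ψ = ∀ w → rank O w < k → Avoids Conflict ψ w

  private
    recolour : ∀ k ψ z → rank O z ≡ k → AvoidsBelow k ψ → ∃ (AvoidsBelow (suc k))
    recolour k ψ z rz≡k avoids = ψ′ , avoids′
      where
        xs = proj₁ (covered z)
        ⊆xs = proj₂ (proj₂ (covered z))
        α∉ = length<⇒∃∉ (map ψ xs)
               (subst (_< c) (sym (length-map ψ xs)) (proj₁ (proj₂ (covered z))))
        α = proj₁ α∉
        ψ′ = updateAt ψ z (const α)

        unchanged : ∀ {y} → y ≢ z → ψ′ y ≡ ψ y
        unchanged y≢z = updateAt-minimal _ z ψ y≢z

        avoids-z : Avoids Conflict ψ′ z
        avoids-z {x} conflict ψ′z≡ψ′x = proj₂ α∉ (subst (_∈ map ψ xs) ψx≡α (∈-map⁺ ψ (⊆xs conflict)))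
          where
            ψx≡α : ψ x ≡ α
            ψx≡α = begin
              ψ x  ≡⟨ unchanged (≺⇒≢ O (downward conflict)) ⟨
              ψ′ x ≡⟨ ψ′z≡ψ′x ⟨
              ψ′ z ≡⟨ updateAt-updates z ψ ⟩
              α    ∎
              where open ≡-Reasoning

        below-z : ∀ {y} → rank O y < k → y ≢ z
        below-z y<k refl = <-irrefl rz≡k y<k

        avoids-below : ∀ w → rank O w < k → Avoids Conflict ψ′ w
        avoids-below w w<k {x} conflict ψ′w≡ψ′x = avoids w w<k conflict (begin
          ψ w  ≡⟨ unchanged (below-z w<k) ⟨
          ψ′ w ≡⟨ ψ′w≡ψ′x ⟩
          ψ′ x ≡⟨ unchanged (below-z (<-trans (downward conflict) w<k)) ⟩
          ψ x  ∎)
          where open ≡-Reasoning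

        avoids′ : AvoidsBelow (suc k) ψ′
        avoids′ w w<1+k with m<1+n⇒m<n∨m≡n w<1+k
        ... | inj₁ w<k = avoids-below w w<k
        ... | inj₂ rw≡k = subst (Avoids Conflict ψ′) (rank-injective O (trans rz≡k (sym rw≡k))) avoids-z

    extend : ∀ k ψ → AvoidsBelow k ψ → ∃ (AvoidsBelow (suc k))
    extend k ψ avoids with any? (λ z → rank O z ≟ k)
    ... | yes (z , rz≡k) = recolour k ψ z rz≡k avoids
    ... | no noneAtK = ψ , λ w w<1+k →
      [ avoids w , (λ rw≡k → ⊥-elim (noneAtK (w , rw≡k))) ]′ (m<1+n⇒m<n∨m≡n w<1+k)

    colouredBelow : ∀ k → ∃ (AvoidsBelow k)
    colouredBelow zero = (λ w → F.fromℕ< (≤-<-trans z≤n (proj₁ (proj₂ (covered w))))) , λ _ ()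
    colouredBelow (suc k) = extend k (proj₁ (colouredBelow k)) (proj₂ (colouredBelow k))

  greedy-colouring : ∃ λ (ψ : Fin n → Fin c) → ∀ w → Avoids Conflict ψ w
  greedy-colouring = proj₁ (colouredBelow n) , λ w → proj₂ (colouredBelow n) w (toℕ<n (proj₁ O w))

module _ {n : ℕ} (G : Graph n) (O : TotalOrder n) where

  private
    _≺_ : Fin n → Fin n → Set
    u ≺ v = u ≺[ O ] v

  adj⇒≢ : ∀ {u v} → Adj G u v → u ≢ v
  adj⇒≢ a refl = irrefl G a

  R-self : ∀ v → InR G O v 2 v
  R-self v = ≤-refl , 0 , z≤n , record
    { p = const v ; start = refl ; end = refl ; edges = λ ()
    ; distinct = λ { {F.zero} {F.zero} _ → refl }
    ; internal = λ { F.zero 0≢0 _ → contradiction refl 0≢0 } }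

  R-lowerNeighbour : ∀ {v u} → Adj G v u → u ≺ v → InR G O v 2 u
  R-lowerNeighbour {v} {u} a u≺v = <⇒≤ u≺v , 1 , s≤s z≤n , record
    { p = p ; start = refl ; end = refl ; edges = λ { F.zero → a } ; distinct = distinct
    ; internal = λ { F.zero 0≢0 _ → contradiction refl 0≢0
                   ; (F.suc F.zero) _ 1≢1 → contradiction refl 1≢1 } }
    where
      p : Fin 2 → Fin n
      p F.zero = v
      p (F.suc F.zero) = u
      distinct : Injective _≡_ _≡_ p
      distinct {F.zero} {F.zero} _ = refl
      distinct {F.zero} {F.suc F.zero} v≡u = contradiction (sym v≡u) (≺⇒≢ O u≺v)
      distinct {F.suc F.zero} {F.zero} u≡v = contradiction u≡v (≺⇒≢ O u≺v)
      distinct {F.suc F.zero} {F.suc F.zero} _ = refl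

  R-viaUpper : ∀ {w v x} → Adj G w v → Adj G v x → w ≺ v → x ≺ w → InR G O w 2 x
  R-viaUpper {w} {v} {x} a b w≺v x≺w = <⇒≤ x≺w , 2 , ≤-refl , record
    { p = p ; start = refl ; end = refl
    ; edges = λ { F.zero → a ; (F.suc F.zero) → b } ; distinct = distinct
    ; internal = λ { F.zero 0≢0 _ → contradiction refl 0≢0 ; (F.suc F.zero) _ _ → w≺v
                   ; (F.suc (F.suc F.zero)) _ 2≢2 → contradiction refl 2≢2 } }
    where
      p : Fin 3 → Fin n
      p F.zero = w
      p (F.suc F.zero) = v
      p (F.suc (F.suc F.zero)) = x
      x≺v : x ≺ v
      x≺v = <-trans x≺w w≺v
      distinct : Injective _≡_ _≡_ p
      distinct {F.zero} {F.zero} _ = refl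
      distinct {F.zero} {F.suc F.zero} e = contradiction e (≺⇒≢ O w≺v)
      distinct {F.zero} {F.suc (F.suc F.zero)} e = contradiction (sym e) (≺⇒≢ O x≺w)
      distinct {F.suc F.zero} {F.zero} e = contradiction (sym e) (≺⇒≢ O w≺v)
      distinct {F.suc F.zero} {F.suc F.zero} _ = refl
      distinct {F.suc F.zero} {F.suc (F.suc F.zero)} e = contradiction (sym e) (≺⇒≢ O x≺v)
      distinct {F.suc (F.suc F.zero)} {F.zero} e = contradiction e (≺⇒≢ O x≺w)
      distinct {F.suc (F.suc F.zero)} {F.suc F.zero} e = contradiction e (≺⇒≢ O x≺v)
      distinct {F.suc (F.suc F.zero)} {F.suc (F.suc F.zero)} _ = refl

  leastNeighbour : Fin n → Fin n
  leastNeighbour v with least? (dec G v) (rank O)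
  ... | inj₁ _ = v
  ... | inj₂ (u , _) = u

  leastNeighbour-least : ∀ {v u} → Adj G v u →
    Adj G v (leastNeighbour v) × (∀ {u'} → Adj G v u' → leastNeighbour v ⪯[ O ] u')
  leastNeighbour-least {v} {u} a with least? (dec G v) (rank O)
  ... | inj₁ none = contradiction a (none u)
  ... | inj₂ (_ , a₀ , min) = a₀ , min

  data Conflict (w : Fin n) : Fin n → Set where
    reach : ∀ {x} → InR G O w 2 x → x ≢ w → Conflict w x
    leastOfLower : ∀ {v} → Adj G w v → v ≺ w → leastNeighbour v ≺ w →
                   Conflict w (leastNeighbour v)

  conflict-downward : ∀ {w x} → Conflict w x → x ≺ w
  conflict-downward (reach (x⪯w , _) x≢w) = ⪯∧≢⇒≺ O x⪯w x≢w
  conflict-downward (leastOfLower _ _ least≺w) = least≺w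

  conflicts-covered : ∀ σ → (∀ v → RBounded G O v 2 σ) →
    ∀ w → ∃ λ xs → length xs < 2 * σ ∸ 1 × ∀ {x} → Conflict w x → x ∈ xs
  conflicts-covered σ bounded w = others ++ map leastNeighbour others , length< , covers
    where
      L = proj₁ (bounded w)
      R⊆L : ∀ {x} → InR G O w 2 x → x ∈ L
      R⊆L = proj₂ (proj₂ (bounded w)) _
      others = filter (λ x → ¬? (x F.≟ w)) L

      others<σ : length others < σ
      others<σ = <-≤-trans
        (filter-notAll _ L (Any.map (λ w≡x x≢w → x≢w (sym w≡x)) (R⊆L (R-self w))))
        (proj₁ (proj₂ (bounded w)))

      length< : length (others ++ map leastNeighbour others) < 2 * σ ∸ 1
      length< = subst (_< 2 * σ ∸ 1)
        (sym (trans (length-++ others) (cong (length others +_) (length-map leastNeighbour others))))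
        (twice<2*∸1 _ σ others<σ)

      covers : ∀ {x} → Conflict w x → x ∈ others ++ map leastNeighbour others
      covers (reach x∈R x≢w) = ∈-++⁺ˡ (∈-filter⁺ _ (R⊆L x∈R) x≢w)
      covers (leastOfLower a v≺w _) =
        ∈-++⁺ʳ others
          (∈-map⁺ leastNeighbour (∈-filter⁺ _ (R⊆L (R-lowerNeighbour a v≺w)) (≺⇒≢ O v≺w)))

  avoiding⇒proper : ∀ {c} (ψ : Fin n → Fin c) → (∀ w → Avoids Conflict ψ w) → Proper G ψ
  avoiding⇒proper ψ avoids u v a with ≢⇒≺⊎≻ O (adj⇒≢ a)
  ... | inj₁ u≺v = avoids v (reach (R-lowerNeighbour (Graph.sym G a) u≺v) (≺⇒≢ O u≺v)) ∘ sym
  ... | inj₂ v≺u = avoids u (reach (R-lowerNeighbour a v≺u) (≺⇒≢ O v≺u))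

  avoiding⇒conflictFree : ∀ {c} (ψ : Fin n → Fin c) → (∀ w → Avoids Conflict ψ w) →
                          ConflictFree G ψ
  avoiding⇒conflictFree ψ avoids v (u , a) =
    ψ least , least , adj-least , refl , unique
    where
      least = leastNeighbour v
      adj-least = proj₁ (leastNeighbour-least a)

      unique : ∀ u' → Adj G v u' → ψ u' ≡ ψ least → u' ≡ least
      unique u' a' same with u' F.≟ least
      ... | yes u'≡least = u'≡least
      ... | no u'≢least = contradiction same (avoids u' conflict)
        where
          least≺u' : least ≺ u'
          least≺u' = ⪯∧≢⇒≺ O (proj₂ (leastNeighbour-least a) a') (u'≢least ∘ sym)
          conflict : Conflict u' least
          conflict with ≢⇒≺⊎≻ O (adj⇒≢ a')
          ... | inj₁ v≺u' = leastOfLower (Graph.sym G a') v≺u' least≺u'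
          ... | inj₂ u'≺v =
            reach (R-viaUpper (Graph.sym G a') adj-least u'≺v least≺u') (≺⇒≢ O least≺u')

  scol₂⇒pcf : ∀ σ → (∀ v → RBounded G O v 2 σ) → HasPCF G (2 * σ ∸ 1)
  scol₂⇒pcf σ bounded with greedy-colouring O Conflict conflict-downward (conflicts-covered σ bounded)
  ... | ψ , avoids = ψ , avoiding⇒proper ψ avoids , avoiding⇒conflictFree ψ avoids

theorem1 : (m : ℕ) (G : Graph (suc m)) (χ σ : ℕ) →
    IsChiPCF G χ → IsScol G 2 σ → χ ≤ 2 * σ ∸ 1
theorem1 m G χ σ (_ , minimal) ((O , bounded) , _) = minimal (2 * σ ∸ 1) (scol₂⇒pcf G O σ bounded)
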